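{- Let $\mathbf{L}$ be a tense ICRDL-algebra and let $\theta$ be a congruence of $\mathbf{L}$. Define $\gamma_\theta$ on $K(L)$ by $(a,b)\,\gamma_\theta\,(x,y)$ iff $(a,x)\in\theta$ and $(b,y)\in\theta$. Then $\gamma_\theta$ is a congruence of the tense DRL-algebra $K(\mathbf{L})$.
   Context: An ICRDL-algebra is a structure $\langle L,\vee,\wedge,\cdot,\to,0,1\rangle$ such that $\langle L,\vee,\wedge,0,1\rangle$ is a bounded distributive lattice, $\langle L,\cdot,1\rangle$ is a commutative monoid, and $x\cdot y\le z$ iff $x\le y\to z$. A tense ICRDL-algebra is an ICRDL-algebra with unary operations $G,H,F,P$ satisfying: (T1) $P(x)\le y$ iff $x\le G(y)$; (T2) $F(x)\le y$ iff $x\le H(y)$; (T3) $G(0)=0$, $H(0)=0$; (T4) $G(x)\cdot F(y)\le F(x\cdot y)$ and $H(x)\cdot P(y)\le P(x\cdot y)$; (T5) $G(x\vee y)\le G(x)\vee F(y)$ and $H(x\vee y)\le H(x)\vee P(y)$; (T6) $G(x\to y)\le G(x)\to G(y)$ and $H(x\to y)\le H(x)\to H(y)$. Congruences are with respect to all these operations. $K(\mathbf{L})$ is the algebra on $K(L)=\{(a,b)\in L\times L:a\cdot b=0\}$ with $(a,b)\vee(x,y)=(a\vee x,b\wedge y)$, $(a,b)\wedge(x,y)=(a\wedge x,b\vee y)$, $(a,b)\ast(x,y)=(a\cdot x,(a\to y)\wedge(x\to b))$, $\sim(a,b)=(b,a)$, $0=(0,1)$, $1=(1,0)$, $c=(0,0)$,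 $G_K(a,b)=(G(a),F(b))$, $H_K(a,b)=(H(a),P(b))$. -}

module Defs where

open import Level using (0ℓ)
open import Data.Product using (Σ; _×_; _,_; proj₁; proj₂)
open import Relation.Binary.PropositionalEquality using (_≡_)
open import Relation.Binary.Definitions using (Reflexive; Symmetric; Transitive)
open import Relation.Binary.Structures using (IsEquivalence)
open import Algebra.Lattice.Structures using (IsDistributiveLattice)
open import Algebra.Structures using (IsCommutativeMonoid)

record TenseICRDL : Set₁ where
  infixr 6 _∨_
  infixr 7 _∧_
  infixl 8 _·_
  infixr 5 _⇒_
  infix 4 _≤_
  field
    Carrier : Set
    _∨_ _∧_ _·_ _⇒_ : Carrier → Carrier → Carrier
    𝟘 𝟙 : Carrier
    G H F P : Carrier → Carrier
    isDistributiveLattice : IsDistributiveLattice {A = Carrier} _≡_ _∨_ _∧_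
    𝟘-least    : ∀ x → 𝟘 ∨ x ≡ x
    𝟙-greatest : ∀ x → 𝟙 ∧ x ≡ x

  _≤_ : Carrier → Carrier → Set
  x ≤ y = x ∧ y ≡ x

  field
    isCommutativeMonoid : IsCommutativeMonoid {A = Carrier} _≡_ _·_ 𝟙
    residuation₁ : ∀ x y z → x · y ≤ z → x ≤ y ⇒ z
    residuation₂ : ∀ x y z → x ≤ y ⇒ z → x · y ≤ z
    T1₁ : ∀ x y → P x ≤ y → x ≤ G y
    T1₂ : ∀ x y → x ≤ G y → P x ≤ y
    T2₁ : ∀ x y → F x ≤ y → x ≤ H y
    T2₂ : ∀ x y → x ≤ H y → F x ≤ y
    T3G : G 𝟘 ≡ 𝟘
    T3H : H 𝟘 ≡ 𝟘
    T4G : ∀ x y → G x · F y ≤ F (x · y)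
    T4H : ∀ x y → H x · P y ≤ P (x · y)
    T5G : ∀ x y → G (x ∨ y) ≤ G x ∨ F y
    T5H : ∀ x y → H (x ∨ y) ≤ H x ∨ P y
    T6G : ∀ x y → G (x ⇒ y) ≤ G x ⇒ G y
    T6H : ∀ x y → H (x ⇒ y) ≤ H x ⇒ H y

module _ (L : TenseICRDL) where
  open TenseICRDL L

  -- congruence of a tense ICRDL-algebra: equivalence relation compatible
  -- with all operations (constants are trivially compatible)
  record IsCongruence (θ : Carrier → Carrier → Set) : Set where
    field
      isEquivalence : IsEquivalence θ
      ∨-cong : ∀ {a b x y} → θ a b → θ x y → θ (a ∨ x) (b ∨ y)
      ∧-cong : ∀ {a b x y} → θ a b → θ x y → θ (a ∧ x) (b ∧ y)
      ·-cong : ∀ {a b x y} → θ a b → θ x y → θ (a · x) (b · y)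
      ⇒-cong : ∀ {a b x y} → θ a b → θ x y → θ (a ⇒ x) (b ⇒ y)
      G-cong : ∀ {a b} → θ a b → θ (G a) (G b)
      H-cong : ∀ {a b} → θ a b → θ (H a) (H b)
      F-cong : ∀ {a b} → θ a b → θ (F a) (F b)
      P-cong : ∀ {a b} → θ a b → θ (P a) (P b)

  K : Set
  K = Σ (Carrier × Carrier) (λ p → proj₁ p · proj₂ p ≡ 𝟘)

  ⌊_⌋ : K → Carrier × Carrier
  ⌊ u ⌋ = proj₁ u

  _∨K_ : Carrier × Carrier → Carrier × Carrier → Carrier × Carrier
  (a , b) ∨K (x , y) = (a ∨ x , b ∧ y)
  _∧K_ : Carrier × Carrier → Carrier × Carrier → Carrier × Carrier
  (a , b) ∧K (x , y) = (a ∧ x , b ∨ y)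
  _∗K_ : Carrier × Carrier → Carrier × Carrier → Carrier × Carrier
  (a , b) ∗K (x , y) = (a · x , (a ⇒ y) ∧ (x ⇒ b))
  ∼K : Carrier × Carrier → Carrier × Carrier
  ∼K (a , b) = (b , a)
  GK : Carrier × Carrier → Carrier × Carrier
  GK (a , b) = (G a , F b)
  HK : Carrier × Carrier → Carrier × Carrier
  HK (a , b) = (H a , P b)

  γ : (Carrier → Carrier → Set) → Carrier × Carrier → Carrier × Carrier → Set
  γ θ (a , b) (x , y) = θ a x × θ b y

  -- congruence of the tense algebra K(L): a relation on K(L) (given via the
  -- underlying pairs) that is an equivalence on K(L) and is compatible with
  -- ∨, ∧, ∗, ∼, G_K, H_K (constants 0, 1, c are trivially compatible).
  record IsCongruenceK (R : Carrier × Carrier → Carrier × Carrier → Set) : Set where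
    field
      refl  : ∀ (u : K) → R ⌊ u ⌋ ⌊ u ⌋
      sym   : ∀ (u v : K) → R ⌊ u ⌋ ⌊ v ⌋ → R ⌊ v ⌋ ⌊ u ⌋
      trans : ∀ (u v w : K) → R ⌊ u ⌋ ⌊ v ⌋ → R ⌊ v ⌋ ⌊ w ⌋ → R ⌊ u ⌋ ⌊ w ⌋
      ∨-cong : ∀ (u u' v v' : K) → R ⌊ u ⌋ ⌊ u' ⌋ → R ⌊ v ⌋ ⌊ v' ⌋
               → R (⌊ u ⌋ ∨K ⌊ v ⌋) (⌊ u' ⌋ ∨K ⌊ v' ⌋)
      ∧-cong : ∀ (u u' v v' : K) → R ⌊ u ⌋ ⌊ u' ⌋ → R ⌊ v ⌋ ⌊ v' ⌋
               → R (⌊ u ⌋ ∧K ⌊ v ⌋) (⌊ u' ⌋ ∧K ⌊ v' ⌋)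
      ∗-cong : ∀ (u u' v v' : K) → R ⌊ u ⌋ ⌊ u' ⌋ → R ⌊ v ⌋ ⌊ v' ⌋
               → R (⌊ u ⌋ ∗K ⌊ v ⌋) (⌊ u' ⌋ ∗K ⌊ v' ⌋)
      ∼-cong : ∀ (u u' : K) → R ⌊ u ⌋ ⌊ u' ⌋ → R (∼K ⌊ u ⌋) (∼K ⌊ u' ⌋)
      G-cong : ∀ (u u' : K) → R ⌊ u ⌋ ⌊ u' ⌋ → R (GK ⌊ u ⌋) (GK ⌊ u' ⌋)
      H-cong : ∀ (u u' : K) → R ⌊ u ⌋ ⌊ u' ⌋ → R (HK ⌊ u ⌋) (HK ⌊ u' ⌋)

{-# OPTIONS --safe #-}
module Submission where

open import Defs
open import Data.Product using (_×_; _,_)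
open import Relation.Binary.Structures using (IsEquivalence)

-- Every operation of K(L) acts componentwise through operations of L, so γ_θ is
-- compatible with it on all of L × L, not only on the pairs with a · b = 0.

module _ (L : TenseICRDL) {θ : TenseICRDL.Carrier L → TenseICRDL.Carrier L → Set}
         (θ-cong : IsCongruence L θ) where

  open TenseICRDL L using (Carrier)
  private
    module θ = IsCongruence θ-cong
    module θ-eq = IsEquivalence θ.isEquivalence

  Pair : Set
  Pair = Carrier × Carrier

  γ-isEquivalence : IsEquivalence (γ L θ)
  γ-isEquivalence = record
    { refl  = θ-eq.refl , θ-eq.refl
    ; sym   = λ (p , q) → θ-eq.sym p , θ-eq.sym q
    ; trans = λ (p , q) (p' , q') → θ-eq.trans p p' , θ-eq.trans q q'
    }

  ∨K-cong : ∀ {u u' v v' : Pair} → γ L θ u u' → γ L θ v v'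
          → γ L θ (_∨K_ L u v) (_∨K_ L u' v')
  ∨K-cong (p , q) (r , s) = θ.∨-cong p r , θ.∧-cong q s

  ∧K-cong : ∀ {u u' v v' : Pair} → γ L θ u u' → γ L θ v v'
          → γ L θ (_∧K_ L u v) (_∧K_ L u' v')
  ∧K-cong (p , q) (r , s) = θ.∧-cong p r , θ.∨-cong q s

  ∗K-cong : ∀ {u u' v v' : Pair} → γ L θ u u' → γ L θ v v'
          → γ L θ (_∗K_ L u v) (_∗K_ L u' v')
  ∗K-cong (p , q) (r , s) = θ.·-cong p r , θ.∧-cong (θ.⇒-cong p s) (θ.⇒-cong r q)

  ∼K-cong : ∀ {u u' : Pair} → γ L θ u u' → γ L θ (∼K L u) (∼K L u')
  ∼K-cong (p , q) = q , p

  GK-cong : ∀ {u u' : Pair} → γ L θ u u' → γ L θ (GK L u) (GK L u')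
  GK-cong (p , q) = θ.G-cong p , θ.F-cong q

  HK-cong : ∀ {u u' : Pair} → γ L θ u u' → γ L θ (HK L u) (HK L u')
  HK-cong (p , q) = θ.H-cong p , θ.P-cong q

mainTheorem13 : (L : TenseICRDL) (θ : TenseICRDL.Carrier L → TenseICRDL.Carrier L → Set)
    → IsCongruence L θ → IsCongruenceK L (γ L θ)
mainTheorem13 L θ θ-cong = record
  { refl   = λ _ → γ.refl
  ; sym    = λ _ _ → γ.sym
  ; trans  = λ _ _ _ → γ.trans
  ; ∨-cong = λ _ _ _ _ → ∨K-cong L θ-cong
  ; ∧-cong = λ _ _ _ _ → ∧K-cong L θ-cong
  ; ∗-cong = λ _ _ _ _ → ∗K-cong L θ-cong
  ; ∼-cong = λ _ _ → ∼K-cong L θ-cong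
  ; G-cong = λ _ _ → GK-cong L θ-cong
  ; H-cong = λ _ _ → HK-cong L θ-cong
  }
  where module γ = IsEquivalence (γ-isEquivalence L θ-cong)
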